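{- Let $t>2$ be an integer and let $1\le A\ll t^2$. Then for every $\epsilon>0$, $$\sum_{\substack{f\in\mathbf{Z}\\ t^2-4-A\le|f|<t^2-4}}\frac{S(t^2-4,f^2)}{\sqrt{t^2-4-|f|}}\ll_\epsilon t^\epsilon\sqrt{A}.$$
   Context: For integers $n_1,\dots,n_r$ (not all zero), $S(n_1,\dots,n_r)=\max\{k\ge1:k^2\mid\gcd(n_1,\dots,n_r)\}$. The hypothesis $A\ll t^2$ means $A\le Kt^2$ for a fixed constant $K$; the implied constant in the conclusion may depend on $\epsilon$ and $K$.
   Formalization: The parameter ε ranges over the positive rationals, and both A and the constant K bounding it are rational. -}

module Defs where

open import Data.Nat as ℕ using (ℕ; zero; suc; _⊔_)
open import Data.Nat.Divisibility using (_∣?_)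
open import Data.Nat.GCD using (gcd)
open import Data.Integer as ℤ using (ℤ; +_)
open import Data.Rational as ℚ using (ℚ; 0ℚ; 1ℚ)
open import Data.Rational.Properties using (_≤?_)
open import Data.List using (List; []; _∷_; foldr; map; upTo; filter)
open import Data.Bool using (if_then_else_)
open import Relation.Nullary.Decidable using (does)
open import Data.Product using (_×_)

sqDiv : ℕ → ℕ
sqDiv g = foldr (λ j acc → if does ((suc j ℕ.* suc j) ∣? g) then suc j ⊔ acc else acc) 1 (upTo g)

-- S(n₁,n₂) = max{k ≥ 1 : k² ∣ gcd(n₁,n₂)}, for natural n (the paper uses n = t²-4 > 0)
-- and an integer f, with gcd(n, f²) = gcd(n, |f|²).
S : ℕ → ℤ → ℕ
S n f = sqDiv (gcd n (ℤ.∣ f ∣ ℕ.* ℤ.∣ f ∣))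

_^ℚ_ : ℚ → ℕ → ℚ
x ^ℚ zero = 1ℚ
x ^ℚ suc k = x ℚ.* (x ^ℚ k)

ℕ→ℚ : ℕ → ℚ
ℕ→ℚ n = (+ n) ℚ./ 1

sumℚ : List ℚ → ℚ
sumℚ = foldr ℚ._+_ 0ℚ

-- the integers f with |f| < n, i.e. -(n-1), …, n-1
smallInts : ℕ → List ℤ
smallInts zero = []
smallInts (suc m) = map (λ k → (+ k) ℤ.- (+ m)) (upTo (suc (m ℕ.+ m)))

range : ℕ → ℚ → List ℤ
range n A = filter (λ f → (ℕ→ℚ n ℚ.- A) ≤? ℕ→ℚ ℤ.∣ f ∣) (smallInts n)

-- "r f is a nonnegative rational lower bound for S(n,f²)/√(n-|f|)":
-- r ≥ 0 and r² · (n - |f|) ≤ S(n,f²)²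
LowerApprox : ℕ → (ℤ → ℚ) → ℤ → Set
LowerApprox n r f =
  (0ℚ ℚ.≤ r f) × ((r f ℚ.* r f) ℚ.* ℕ→ℚ (n ℕ.∸ ℤ.∣ f ∣) ℚ.≤ ℕ→ℚ (S n f ℕ.* S n f))

{-# OPTIONS --safe #-}

-- Group the f in the range by k = S(n, f²), a divisor of n = t² - 4. Since k divides n and f,
-- the terms of a group sit at multiples m = n - |f| ≤ A of k and are at most k / √m, so a group
-- contributes at most 2 √A for each sign of f. With d(n) groups the sum is at most 4 d(n) √A,
-- and the divisor bound d(n)^(2Q) ≪ n ≤ t², with Q = q + 1, gives d(n) ≪ t^(p/Q) = t^ε.
-- Square roots are avoided throughout by comparing squares.

module Submission where

open import Defs
open import Data.Nat as ℕ using (ℕ; suc)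
open import Data.Rational as ℚ using (ℚ; 0ℚ; 1ℚ)
open import Data.Product using (Σ; _×_)
open import Data.List using (map)
open import Data.Integer using (ℤ)
open import Data.List.Relation.Unary.All using (All)
import Data.Nat.Properties as ℕₚ
import Data.Integer.Base as ℤ

module DivisorCount where

  open import Data.Nat.Base
  open import Data.Nat.Properties
  open import Data.Nat.Divisibility
  open import Data.Nat.Primality
  open import Data.Nat.Coprimality using (Coprime; coprime-divisor)
  open import Data.Nat.DivMod using (_/_; _%_; m≡m%n+[m/n]*n; m%n<n)
  open import Data.Nat.Induction using (<-wellFounded)
  open import Data.Nat.Tactic.RingSolver using (solve-∀)
  open import Induction.WellFounded using (Acc; acc)
  open import Data.List.Base using (List; []; _∷_; _++_; length)
  open import Data.List.Properties using (length-++; length-map)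
  open import Data.List.Membership.Propositional using (_∈_)
  open import Data.List.Membership.Propositional.Properties using (∈-++⁺ˡ; ∈-++⁺ʳ; ∈-map⁺)
  open import Data.List.Relation.Unary.Any using (here)
  open import Data.Product.Base using (∃-syntax; ∃₂; _,_)
  open import Data.Sum.Base using (inj₁; inj₂)
  open import Relation.Binary.PropositionalEquality
  open import Relation.Nullary using (¬_; yes; no; contradiction)

  ^-distribʳ-* : ∀ m n o → (m * n) ^ o ≡ m ^ o * n ^ o
  ^-distribʳ-* m n zero    = refl
  ^-distribʳ-* m n (suc o) = begin
    m * n * (m * n) ^ o     ≡⟨ cong (m * n *_) (^-distribʳ-* m n o) ⟩
    m * n * (m ^ o * n ^ o) ≡⟨ interchange m n (m ^ o) (n ^ o) ⟩
    m * m ^ o * (n * n ^ o) ∎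
    where
    open ≡-Reasoning
    interchange : ∀ w x y z → w * x * (y * z) ≡ w * y * (x * z)
    interchange = solve-∀

  1+n≤2^n : ∀ n → suc n ≤ 2 ^ n
  1+n≤2^n zero    = ≤-refl
  1+n≤2^n (suc n) = +-mono-≤ (m^n>0 2 n) (≤-trans (1+n≤2^n n) (≤-reflexive (sym (+-identityʳ _))))

  -- With e = r + q a and r < a we get 1 + e ≤ a (1 + q) ≤ a 2^q.
  [1+e]^a≤a^a*2^e : ∀ a .{{_ : NonZero a}} e → suc e ^ a ≤ a ^ a * 2 ^ e
  [1+e]^a≤a^a*2^e a e = begin
    suc e ^ a             ≤⟨ ^-monoˡ-≤ a 1+e≤a*2^q ⟩
    (a * 2 ^ q) ^ a       ≡⟨ ^-distribʳ-* a (2 ^ q) a ⟩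
    a ^ a * (2 ^ q) ^ a   ≡⟨ cong (a ^ a *_) (^-*-assoc 2 q a) ⟩
    a ^ a * 2 ^ (q * a)   ≤⟨ *-monoʳ-≤ (a ^ a) (^-monoʳ-≤ 2 (m≤n+m (q * a) (e % a))) ⟩
    a ^ a * 2 ^ (e % a + q * a) ≡⟨ cong (λ x → a ^ a * 2 ^ x) (m≡m%n+[m/n]*n e a) ⟨
    a ^ a * 2 ^ e         ∎
    where
    open ≤-Reasoning
    q = e / a
    1+e≤a*2^q : suc e ≤ a * 2 ^ q
    1+e≤a*2^q = begin
      suc e               ≡⟨ cong suc (m≡m%n+[m/n]*n e a) ⟩
      suc (e % a) + q * a ≤⟨ +-monoˡ-≤ (q * a) (m%n<n e a) ⟩
      a + q * a           ≡⟨ *-comm (suc q) a ⟩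
      a * suc q           ≤⟨ *-monoʳ-≤ a (1+n≤2^n q) ⟩
      a * 2 ^ q           ∎

  [1+e]^a≤p^e : ∀ a e {p} → 2 ^ a ≤ p → suc e ^ a ≤ p ^ e
  [1+e]^a≤p^e a e {p} 2^a≤p = begin
    suc e ^ a     ≤⟨ ^-monoˡ-≤ a (1+n≤2^n e) ⟩
    (2 ^ e) ^ a   ≡⟨ ^-*-assoc 2 e a ⟩
    2 ^ (e * a)   ≡⟨ cong (2 ^_) (*-comm e a) ⟩
    2 ^ (a * e)   ≡⟨ ^-*-assoc 2 a e ⟨
    (2 ^ a) ^ e   ≤⟨ ^-monoˡ-≤ e 2^a≤p ⟩
    p ^ e         ∎
    where open ≤-Reasoning

  AllDivisorsIn : ℕ → List ℕ → Set
  AllDivisorsIn n ks = ∀ {k} → k ∣ n → k ∈ ks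

  -- A constructive form of d(n)^a ≤ b n.
  DivisorCountBound : ℕ → ℕ → ℕ → Set
  DivisorCountBound a b n = ∃[ ks ] AllDivisorsIn n ks × length ks ^ a ≤ b * n

  timesPowers : ℕ → ℕ → List ℕ → List ℕ
  timesPowers p zero    ks = ks
  timesPowers p (suc e) ks = ks ++ map (p *_) (timesPowers p e ks)

  length-timesPowers : ∀ p e ks → length (timesPowers p e ks) ≡ suc e * length ks
  length-timesPowers p zero    ks = sym (+-identityʳ _)
  length-timesPowers p (suc e) ks = begin
    length (ks ++ map (p *_) (timesPowers p e ks))
      ≡⟨ length-++ ks ⟩
    length ks + length (map (p *_) (timesPowers p e ks))
      ≡⟨ cong (length ks +_) (length-map (p *_) (timesPowers p e ks)) ⟩
    length ks + length (timesPowers p e ks)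
      ≡⟨ cong (length ks +_) (length-timesPowers p e ks) ⟩
    length ks + suc e * length ks ∎
    where open ≡-Reasoning

  prime∤⇒coprime : ∀ {p k} → Prime p → ¬ p ∣ k → Coprime k p
  prime∤⇒coprime pp p∤k (d∣k , d∣p) with prime⇒irreducible pp d∣p
  ... | inj₁ d≡1 = d≡1
  ... | inj₂ refl = contradiction d∣k p∤k

  coprime-∣-^* : ∀ {k p} → Coprime k p → ∀ e {m} → k ∣ p ^ e * m → k ∣ m
  coprime-∣-^* {k}     k⊥p zero    {m} k∣ = subst (k ∣_) (+-identityʳ m) k∣
  coprime-∣-^* {k} {p} k⊥p (suc e) {m} k∣ =
    coprime-∣-^* k⊥p e (coprime-divisor k⊥p (subst (k ∣_) (*-assoc p (p ^ e) m) k∣))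

  allDivisorsIn-timesPowers : ∀ {p m ks} → Prime p → AllDivisorsIn m ks →
                              ∀ e → AllDivisorsIn (p ^ e * m) (timesPowers p e ks)
  allDivisorsIn-timesPowers {p} {m} {ks} pp m⊆ks zero k∣ = m⊆ks (subst (_ ∣_) (+-identityʳ m) k∣)
  allDivisorsIn-timesPowers {p} {m} {ks} pp m⊆ks (suc e) {k} k∣ with p ∣? k
  ... | no  p∤k = ∈-++⁺ˡ (m⊆ks (coprime-∣-^* (prime∤⇒coprime pp p∤k) (suc e) k∣))
  ... | yes (divides j refl) = ∈-++⁺ʳ ks (subst (_∈ map (p *_) (timesPowers p e ks)) (*-comm p j)
          (∈-map⁺ (p *_) (allDivisorsIn-timesPowers pp m⊆ks e j∣)))
    where
    instance _ = prime⇒nonZero pp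
    j∣ : j ∣ p ^ e * m
    j∣ = *-cancelˡ-∣ p (subst₂ _∣_ (*-comm j p) (*-assoc p (p ^ e) m) k∣)

  ∣⇒≡^suc*∤ : ∀ {p} → 1 < p → ∀ {n} .{{_ : NonZero n}} → p ∣ n →
              ∃₂ λ e m → n ≡ p ^ suc e * m × ¬ p ∣ m
  ∣⇒≡^suc*∤ {p} 1<p {n} = go n (<-wellFounded n)
    where
    go : ∀ n .{{_ : NonZero n}} → Acc _<_ n → p ∣ n → ∃₂ λ e m → n ≡ p ^ suc e * m × ¬ p ∣ m
    go n (acc rec) p∣n@(divides q n≡q*p) with p ∣? q
    ... | no p∤q = 0 , q , trans n≡q*p (comm p q) , p∤q
      where
      comm : ∀ p q → q * p ≡ p * 1 * q
      comm = solve-∀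
    ... | yes p∣q with go q {{quotient≢0 p∣n}} (rec (quotient-< p∣n {{n>1⇒nonTrivial 1<p}})) p∣q
    ... | e , m , q≡ , p∤m = suc e , m , (begin
      n                   ≡⟨ n≡q*p ⟩
      q * p               ≡⟨ cong (_* p) q≡ ⟩
      p * p ^ e * m * p   ≡⟨ reassoc p (p ^ e) m ⟩
      p * (p * p ^ e) * m ∎) , p∤m
      where
      open ≡-Reasoning
      reassoc : ∀ x y z → x * y * z * x ≡ x * (x * y) * z
      reassoc = solve-∀

  rough⇒leastDivisor : ∀ {L n} → L ≤ n → L Rough n → ∃[ p ] L ≤ p × p ∣ n × p Rough n
  rough⇒leastDivisor {L} {n} L≤n = go (n ∸ L) (m∸n+n≡m L≤n)
    where
    go : ∀ gap {L} → gap + L ≡ n → L Rough n → ∃[ p ] L ≤ p × p ∣ n × p Rough n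
    go gap {L} eq rough with L ∣? n
    ... | yes L∣n = L , ≤-refl , L∣n , rough
    go zero      refl rough | no L∤n = contradiction ∣-refl L∤n
    go (suc gap) {L} eq rough | no L∤n
      with go gap {suc L} (trans (+-suc gap L) eq) (∤⇒rough-suc L∤n rough)
    ... | p , 1+L≤p , p∣n , p-rough = p , ≤-trans (n≤1+n L) 1+L≤p , p∣n , p-rough

  module _ (a : ℕ) .{{_ : NonZero a}} where

    -- A bound for d(n)^a / n on L-rough n: a prime factor p^e contributes (1+e)^a / p^e,
    -- which is at most a^a if p < 2^a and at most 1 otherwise, and at most 2^a ∸ L
    -- primes in [L, 2^a) can occur.
    weight : ℕ → ℕ
    weight L = (a ^ a) ^ (2 ^ a ∸ L)

    private instance
      a^a≢0 : NonZero (a ^ a)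
      a^a≢0 = m^n≢0 a a

    weight>0 : ∀ L → 0 < weight L
    weight>0 L = m^n>0 (a ^ a) (2 ^ a ∸ L)

    weight-antitone : ∀ {L L′} → L ≤ L′ → weight L′ ≤ weight L
    weight-antitone L≤L′ = ^-monoʳ-≤ (a ^ a) (∸-monoʳ-≤ (2 ^ a) L≤L′)

    weight-step : ∀ {p} → 2 ≤ p → ∀ e → suc e ^ a * weight (suc p) ≤ weight p * p ^ e
    weight-step {p} 2≤p e with 2 ^ a ≤? p
    ... | yes 2^a≤p rewrite m≤n⇒m∸n≡0 2^a≤p | m≤n⇒m∸n≡0 (m≤n⇒m≤1+n 2^a≤p) = begin
      suc e ^ a * 1 ≡⟨ *-identityʳ _ ⟩
      suc e ^ a     ≤⟨ [1+e]^a≤p^e a e 2^a≤p ⟩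
      p ^ e         ≡⟨ *-identityˡ _ ⟨
      1 * p ^ e     ∎
      where open ≤-Reasoning
    ... | no  2^a≰p rewrite +-∸-assoc 1 (≰⇒> 2^a≰p) = begin
      suc e ^ a * w      ≤⟨ *-monoˡ-≤ w ([1+e]^a≤a^a*2^e a e) ⟩
      a ^ a * 2 ^ e * w  ≤⟨ *-monoˡ-≤ w (*-monoʳ-≤ (a ^ a) (^-monoˡ-≤ e 2≤p)) ⟩
      a ^ a * p ^ e * w  ≡⟨ swap (a ^ a) (p ^ e) w ⟩
      a ^ a * w * p ^ e  ∎
      where
      open ≤-Reasoning
      w = weight (suc p)
      swap : ∀ x y z → x * y * z ≡ x * z * y
      swap = solve-∀

    length-timesPowers-bound : ∀ {p} → 2 ≤ p → ∀ e {m ks} → length ks ^ a ≤ weight (suc p) * m →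
                               length (timesPowers p e ks) ^ a ≤ weight p * (p ^ e * m)
    length-timesPowers-bound {p} 2≤p e {m} {ks} ks-bound = begin
      length (timesPowers p e ks) ^ a     ≡⟨ cong (_^ a) (length-timesPowers p e ks) ⟩
      (suc e * length ks) ^ a             ≡⟨ ^-distribʳ-* (suc e) (length ks) a ⟩
      suc e ^ a * length ks ^ a           ≤⟨ *-monoʳ-≤ (suc e ^ a) ks-bound ⟩
      suc e ^ a * (weight (suc p) * m)    ≡⟨ *-assoc (suc e ^ a) (weight (suc p)) m ⟨
      suc e ^ a * weight (suc p) * m      ≤⟨ *-monoˡ-≤ m (weight-step 2≤p e) ⟩
      weight p * p ^ e * m                ≡⟨ *-assoc (weight p) (p ^ e) m ⟩
      weight p * (p ^ e * m)              ∎
      where open ≤-Reasoning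

    divisorCountBound-mono : ∀ {b b′ n} → b ≤ b′ → DivisorCountBound a b n → DivisorCountBound a b′ n
    divisorCountBound-mono {n = n} b≤b′ (ks , n⊆ks , bound) =
      ks , n⊆ks , ≤-trans bound (*-monoˡ-≤ n b≤b′)

    divisorCountBound-rough : ∀ n .{{_ : NonZero n}} {L} → 2 ≤ L → L Rough n →
                              DivisorCountBound a (weight L) n
    divisorCountBound-rough n = go n (<-wellFounded n)
      where
      go : ∀ n .{{_ : NonZero n}} → Acc _<_ n → ∀ {L} → 2 ≤ L → L Rough n →
           DivisorCountBound a (weight L) n
      go-least : ∀ n .{{_ : NonZero n}} → Acc _<_ n → ∀ {p} → 2 ≤ p → p ∣ n → p Rough n →
                 DivisorCountBound a (weight p) n

      go 1 _ {L} _ _ =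
        1 ∷ [] , (λ k∣1 → here (∣1⇒≡1 k∣1)) ,
        ≤-trans (≤-reflexive (^-zeroˡ a)) (*-monoˡ-≤ 1 (weight>0 L))
      go n@(2+ _) accn 2≤L L-rough with rough⇒leastDivisor (rough⇒≤ L-rough) L-rough
      ... | p , L≤p , p∣n , p-rough =
        divisorCountBound-mono (weight-antitone L≤p) (go-least n accn (≤-trans 2≤L L≤p) p∣n p-rough)

      go-least n (acc rec) {p} 2≤p p∣n p-rough with ∣⇒≡^suc*∤ 2≤p p∣n
      ... | e , m , n≡ , p∤m with go m (rec m<n) (≤-trans 2≤p (n≤1+n p)) m-rough
        where
        instance
          _ = n>1⇒nonTrivial 2≤p
          _ = m*n≢0⇒n≢0 (p ^ suc e) {{subst NonZero n≡ (≢-nonZero (≢-nonZero⁻¹ n))}}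
        m<n : m < n
        m<n = subst (m <_) (trans (*-comm m (p ^ suc e)) (sym n≡))
                    (m<m*n m (p ^ suc e) (^-monoʳ-< p 2≤p {0} {suc e} z<s))
        m-rough : suc p Rough m
        m-rough = ∤⇒rough-suc p∤m (rough∧∣⇒rough p-rough (divides (p ^ suc e) n≡))
      ... | ks , m⊆ks , ks-bound =
        timesPowers p (suc e) ks ,
        subst (λ x → AllDivisorsIn x (timesPowers p (suc e) ks)) (sym n≡)
              (allDivisorsIn-timesPowers (rough∧∣⇒prime p-rough p∣n) m⊆ks (suc e)) ,
        subst (λ x → length (timesPowers p (suc e) ks) ^ a ≤ weight p * x) (sym n≡)
              (length-timesPowers-bound 2≤p (suc e) {m} {ks} ks-bound)
        where instance _ = n>1⇒nonTrivial 2≤p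

    divisorCountBound : ∀ n .{{_ : NonZero n}} → DivisorCountBound a (weight 2) n
    divisorCountBound n = divisorCountBound-rough n ≤-refl 2-rough

module SquareDivisor where

  open import Data.Nat.Base
  open import Data.Nat.Properties
  open import Data.Nat.Divisibility
  open import Data.Nat.Coprimality using (Coprime; coprime-divisor; coprime-/gcd)
  open import Data.Nat.GCD using (gcd; gcd[m,n]∣m; gcd[m,n]∣n; gcd[m,n]≢0)
  open import Data.Nat.DivMod using (_/_; m/n*n≡m)
  open import Data.Nat.Tactic.RingSolver using (solve-∀)
  open import Data.List.Base using ([]; _∷_; foldr; upTo)
  open import Data.Bool.Base using (if_then_else_)
  open import Data.Product.Base using (_,_)
  open import Data.Sum.Base using (inj₁; inj₂)
  open import Function.Base using (id)
  open import Relation.Binary.PropositionalEquality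
  open import Relation.Nullary using (yes; no; does)
  open import Relation.Unary using (Decidable)

  foldr-⊔-if-preserves : ∀ (P : ℕ → Set) {Q : ℕ → Set} (Q? : Decidable Q) →
                         P 1 → (∀ {j} → Q j → P (suc j)) →
                         ∀ js → P (foldr (λ j acc → if does (Q? j) then suc j ⊔ acc else acc) 1 js)
  foldr-⊔-if-preserves P Q? P1 PQ []       = P1
  foldr-⊔-if-preserves P Q? P1 PQ (j ∷ js) with Q? j
  ... | no  _ = foldr-⊔-if-preserves P Q? P1 PQ js
  ... | yes q with ⊔-sel (suc j) (foldr (λ j acc → if does (Q? j) then suc j ⊔ acc else acc) 1 js)
  ...   | inj₁ ⊔≡suc rewrite ⊔≡suc = PQ q
  ...   | inj₂ ⊔≡acc rewrite ⊔≡acc = foldr-⊔-if-preserves P Q? P1 PQ js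

  sqDiv²∣ : ∀ g → sqDiv g * sqDiv g ∣ g
  sqDiv²∣ g = foldr-⊔-if-preserves (λ k → k * k ∣ g) (λ j → suc j * suc j ∣? g) (1∣ g) id (upTo g)

  -- With g = gcd m n, m = m′ g and n = n′ g: m′² divides n′² and is coprime to it, so m′ = 1.
  m*m∣n*n⇒m∣n : ∀ m n → m * m ∣ n * n → m ∣ n
  m*m∣n*n⇒m∣n zero    n 0∣n*n with m*n≡0⇒m≡0∨n≡0 n (0∣⇒≡0 0∣n*n)
  ... | inj₁ refl = ∣-refl
  ... | inj₂ refl = ∣-refl
  m*m∣n*n⇒m∣n m@(suc _) n mm∣nn = subst (_∣ n) g≡m (gcd[m,n]∣n m n)
    where
    g = gcd m n
    instance
      g≢0 : NonZero g
      g≢0 = ≢-nonZero (gcd[m,n]≢0 m n (inj₁ λ ()))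
      gg≢0 : NonZero (g * g)
      gg≢0 = m*n≢0 g g
    m′ = m / g
    n′ = n / g
    m′⊥n′ : Coprime m′ n′
    m′⊥n′ = coprime-/gcd m n
    square-* : ∀ x y → (x * y) * (x * y) ≡ (x * x) * (y * y)
    square-* = solve-∀
    squared : ∀ {x} → g ∣ x → (x / g) * (x / g) * (g * g) ≡ x * x
    squared {x} g∣x = trans (sym (square-* (x / g) g)) (cong₂ _*_ (m/n*n≡m g∣x) (m/n*n≡m g∣x))
    m′m′∣n′n′ : m′ * m′ ∣ n′ * n′
    m′m′∣n′n′ = *-cancelʳ-∣ (g * g)
      (subst₂ _∣_ (sym (squared (gcd[m,n]∣m m n))) (sym (squared (gcd[m,n]∣n m n))) mm∣nn)
    m′≡1 : m′ ≡ 1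
    m′≡1 = m′⊥n′ (∣-refl , coprime-divisor m′⊥n′ (∣-trans (n∣m*n m′) m′m′∣n′n′))
    g≡m : g ≡ m
    g≡m = trans (sym (*-identityˡ g)) (trans (cong (_* g) (sym m′≡1)) (m/n*n≡m (gcd[m,n]∣m m n)))

  S²∣gcd : ∀ n f → S n f * S n f ∣ gcd n (ℤ.∣ f ∣ * ℤ.∣ f ∣)
  S²∣gcd n f = sqDiv²∣ (gcd n (ℤ.∣ f ∣ * ℤ.∣ f ∣))

  S∣n : ∀ n f → S n f ∣ n
  S∣n n f = ∣-trans (n∣m*n (S n f)) (∣-trans (S²∣gcd n f) (gcd[m,n]∣m n _))

  S∣∣f∣ : ∀ n f → S n f ∣ ℤ.∣ f ∣
  S∣∣f∣ n f = m*m∣n*n⇒m∣n (S n f) ℤ.∣ f ∣ (∣-trans (S²∣gcd n f) (gcd[m,n]∣n n _))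

  S∣n∸∣f∣ : ∀ n f → S n f ∣ n ∸ ℤ.∣ f ∣
  S∣n∸∣f∣ n f with ℤ.∣ f ∣ ≤? n
  ... | yes ∣f∣≤n = ∣m+n∣m⇒∣n (subst (S n f ∣_) (sym (m+[n∸m]≡n ∣f∣≤n)) (S∣n n f)) (S∣∣f∣ n f)
  ... | no  ∣f∣≰n rewrite m≤n⇒m∸n≡0 (<⇒≤ (≰⇒> ∣f∣≰n)) = S n f ∣0

module RationalArithmetic where

  open import Data.Nat.Base using (zero)
  open import Data.Nat.Coprimality as Coprimality using ()
  open import Data.Integer.Base using (+_)
  import Data.Integer.Properties as ℤₚ
  open import Data.Rational.Base
  open import Data.Rational.Properties
  open import Data.Rational.Solver using (module +-*-Solver)
  open import Relation.Binary.PropositionalEquality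
  open import Relation.Nullary using (yes; no; contradiction)

  open +-*-Solver

  ℕ→ℚ≡mkℚ : ∀ m → ℕ→ℚ m ≡ mkℚ (+ m) 0 (Coprimality.sym (Coprimality.1-coprimeTo m))
  ℕ→ℚ≡mkℚ m = normalize-coprime _

  ℕ→ℚ-+ : ∀ m n → ℕ→ℚ (m ℕ.+ n) ≡ ℕ→ℚ m + ℕ→ℚ n
  ℕ→ℚ-+ m n rewrite ℕ→ℚ≡mkℚ m | ℕ→ℚ≡mkℚ n =
    cong (_/ 1) (trans (ℤₚ.pos-+ m n) (sym (cong₂ ℤ._+_ (ℤₚ.*-identityʳ (+ m)) (ℤₚ.*-identityʳ (+ n)))))

  ℕ→ℚ-suc : ∀ n → ℕ→ℚ (suc n) ≡ ℕ→ℚ n + 1ℚ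
  ℕ→ℚ-suc n = trans (ℕ→ℚ-+ 1 n) (+-comm 1ℚ (ℕ→ℚ n))

  ℕ→ℚ-* : ∀ m n → ℕ→ℚ (m ℕ.* n) ≡ ℕ→ℚ m * ℕ→ℚ n
  ℕ→ℚ-* m n rewrite ℕ→ℚ≡mkℚ m | ℕ→ℚ≡mkℚ n = cong (_/ 1) (ℤₚ.pos-* m n)

  ℕ→ℚ-^ : ∀ m k → ℕ→ℚ (m ℕ.^ k) ≡ ℕ→ℚ m ^ℚ k
  ℕ→ℚ-^ m zero    = refl
  ℕ→ℚ-^ m (suc k) = trans (ℕ→ℚ-* m (m ℕ.^ k)) (cong (ℕ→ℚ m *_) (ℕ→ℚ-^ m k))

  ℕ→ℚ-∸ : ∀ {m n} → n ℕ.≤ m → ℕ→ℚ (m ℕ.∸ n) ≡ ℕ→ℚ m - ℕ→ℚ n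
  ℕ→ℚ-∸ {m} {n} n≤m = begin
    ℕ→ℚ (m ℕ.∸ n)                   ≡⟨ solve 2 (λ x y → x := x :+ y :- y) refl (ℕ→ℚ (m ℕ.∸ n)) (ℕ→ℚ n) ⟩
    ℕ→ℚ (m ℕ.∸ n) + ℕ→ℚ n - ℕ→ℚ n   ≡⟨ cong (_- ℕ→ℚ n) (ℕ→ℚ-+ (m ℕ.∸ n) n) ⟨
    ℕ→ℚ (m ℕ.∸ n ℕ.+ n) - ℕ→ℚ n     ≡⟨ cong (λ x → ℕ→ℚ x - ℕ→ℚ n) (ℕₚ.m∸n+n≡m n≤m) ⟩
    ℕ→ℚ m - ℕ→ℚ n                   ∎
    where open ≡-Reasoning

  ℕ→ℚ-mono-≤ : ∀ {m n} → m ℕ.≤ n → ℕ→ℚ m ≤ ℕ→ℚ n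
  ℕ→ℚ-mono-≤ {m} {n} m≤n rewrite ℕ→ℚ≡mkℚ m | ℕ→ℚ≡mkℚ n =
    *≤* (subst₂ ℤ._≤_ (sym (ℤₚ.*-identityʳ (+ m))) (sym (ℤₚ.*-identityʳ (+ n))) (ℤ.+≤+ m≤n))

  ℕ→ℚ-mono-< : ∀ {m n} → m ℕ.< n → ℕ→ℚ m < ℕ→ℚ n
  ℕ→ℚ-mono-< {m} {n} m<n rewrite ℕ→ℚ≡mkℚ m | ℕ→ℚ≡mkℚ n =
    *<* (subst₂ ℤ._<_ (sym (ℤₚ.*-identityʳ (+ m))) (sym (ℤₚ.*-identityʳ (+ n))) (ℤ.+<+ m<n))

  0≤ℕ→ℚ : ∀ n → 0ℚ ≤ ℕ→ℚ n
  0≤ℕ→ℚ n = ℕ→ℚ-mono-≤ {0} {n} ℕ.z≤n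

  p≤p+q : ∀ p {q} → 0ℚ ≤ q → p ≤ p + q
  p≤p+q p 0≤q = subst (_≤ p + _) (+-identityʳ p) (+-monoʳ-≤ p 0≤q)

  p-r≤q⇒p-q≤r : ∀ {p q r} → p - r ≤ q → p - q ≤ r
  p-r≤q⇒p-q≤r {p} {q} {r} p-r≤q = begin
    p - q               ≡⟨ solve 3 (λ p q r → p :- q := (p :- r) :+ (r :- q)) refl p q r ⟩
    (p - r) + (r - q)   ≤⟨ +-monoˡ-≤ (r - q) p-r≤q ⟩
    q + (r - q)         ≡⟨ solve 2 (λ q r → q :+ (r :- q) := r) refl q r ⟩
    r                   ∎
    where open ≤-Reasoning

  *-monoˡ-≤-0≤ : ∀ {r p q} → 0ℚ ≤ r → p ≤ q → r * p ≤ r * q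
  *-monoˡ-≤-0≤ {r} 0≤r = *-monoˡ-≤-nonNeg r {{nonNegative 0≤r}}

  *-monoʳ-≤-0≤ : ∀ {r p q} → 0ℚ ≤ r → p ≤ q → p * r ≤ q * r
  *-monoʳ-≤-0≤ {r} 0≤r = *-monoʳ-≤-nonNeg r {{nonNegative 0≤r}}

  *-mono-≤-0≤ : ∀ {p q r s} → 0ℚ ≤ p → 0ℚ ≤ r → p ≤ q → r ≤ s → p * r ≤ q * s
  *-mono-≤-0≤ 0≤p 0≤r p≤q r≤s = ≤-trans (*-monoʳ-≤-0≤ 0≤r p≤q) (*-monoˡ-≤-0≤ (≤-trans 0≤p p≤q) r≤s)

  0≤* : ∀ {p q} → 0ℚ ≤ p → 0ℚ ≤ q → 0ℚ ≤ p * q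
  0≤* {p} 0≤p 0≤q = subst (_≤ p * _) (*-zeroʳ p) (*-monoˡ-≤-0≤ 0≤p 0≤q)

  *-cancelʳ-≤-0< : ∀ {r p q} → 0ℚ < r → p * r ≤ q * r → p ≤ q
  *-cancelʳ-≤-0< {r} 0<r = *-cancelʳ-≤-pos r {{positive 0<r}}

  square-cancel-≤ : ∀ {p q} → 0ℚ ≤ q → p * p ≤ q * q → p ≤ q
  square-cancel-≤ {p} {q} 0≤q p²≤q² with p ≤? q
  ... | yes p≤q = p≤q
  ... | no  p≰q = contradiction (<-≤-trans q²<p² p²≤q²) (<-irrefl refl)
    where
    q<p = ≰⇒> p≰q
    instance _ = positive (≤-<-trans 0≤q q<p)
    q²<p² : q * q < p * p
    q²<p² = ≤-<-trans (*-monoˡ-≤-0≤ 0≤q (<⇒≤ q<p)) (*-monoˡ-<-pos p q<p)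

  0≤^ℚ : ∀ {p} k → 0ℚ ≤ p → 0ℚ ≤ p ^ℚ k
  0≤^ℚ zero    0≤p = 0≤ℕ→ℚ 1
  0≤^ℚ (suc k) 0≤p = 0≤* 0≤p (0≤^ℚ k 0≤p)

  ^ℚ-mono-≤ : ∀ {p q} k → 0ℚ ≤ p → p ≤ q → p ^ℚ k ≤ q ^ℚ k
  ^ℚ-mono-≤ zero    0≤p p≤q = ≤-refl
  ^ℚ-mono-≤ (suc k) 0≤p p≤q = *-mono-≤-0≤ 0≤p (0≤^ℚ k 0≤p) p≤q (^ℚ-mono-≤ k 0≤p p≤q)

  ^ℚ-distrib-* : ∀ p q k → (p * q) ^ℚ k ≡ p ^ℚ k * q ^ℚ k
  ^ℚ-distrib-* p q zero    = refl
  ^ℚ-distrib-* p q (suc k) = trans (cong (p * q *_) (^ℚ-distrib-* p q k))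
    (solve 4 (λ a b c d → (a :* b) :* (c :* d) := (a :* c) :* (b :* d)) refl p q (p ^ℚ k) (q ^ℚ k))

  ^ℚ-+ : ∀ p j k → p ^ℚ (j ℕ.+ k) ≡ p ^ℚ j * p ^ℚ k
  ^ℚ-+ p zero    k = sym (*-identityˡ _)
  ^ℚ-+ p (suc j) k = trans (cong (p *_) (^ℚ-+ p j k)) (sym (*-assoc p _ _))

  ^ℚ-2* : ∀ p k → p ^ℚ (2 ℕ.* k) ≡ (p * p) ^ℚ k
  ^ℚ-2* p k = begin
    p ^ℚ (k ℕ.+ (k ℕ.+ 0))  ≡⟨ cong (λ j → p ^ℚ (k ℕ.+ j)) (ℕₚ.+-identityʳ k) ⟩
    p ^ℚ (k ℕ.+ k)          ≡⟨ ^ℚ-+ p k k ⟩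
    p ^ℚ k * p ^ℚ k         ≡⟨ ^ℚ-distrib-* p p k ⟨
    (p * p) ^ℚ k            ∎
    where open ≡-Reasoning

module RationalSums where

  open RationalArithmetic
  open import Data.Nat.Base using (zero)
  open import Data.Rational.Base
  open import Data.Rational.Properties
  open import Data.Rational.Solver using (module +-*-Solver)
  open import Data.List.Base using ([]; _∷_; filter; applyUpTo; length)
  open import Data.List.Membership.Propositional using (_∈_)
  open import Data.List.Relation.Unary.Any using (here; there)
  open import Data.Product.Base using (_,_)
  open import Function.Base using (_∘_)
  open import Relation.Binary.PropositionalEquality
  open import Relation.Nullary using (yes; no; contradiction)
  open import Relation.Unary using (Pred; Decidable)

  open +-*-Solver

  -- p ≤√ X says 0 ≤ p ≤ √X; ℚ has no square roots.
  infix 4 _≤√_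
  _≤√_ : ℚ → ℚ → Set
  p ≤√ X = 0ℚ ≤ p × p * p ≤ X

  ≤√-monoʳ : ∀ {p X Y} → X ≤ Y → p ≤√ X → p ≤√ Y
  ≤√-monoʳ X≤Y (0≤p , p²≤X) = 0≤p , ≤-trans p²≤X X≤Y

  ≤-≤√-trans : ∀ {p q X} → 0ℚ ≤ p → p ≤ q → q ≤√ X → p ≤√ X
  ≤-≤√-trans 0≤p p≤q (0≤q , q²≤X) = 0≤p , ≤-trans (*-mono-≤-0≤ 0≤p 0≤p p≤q p≤q) q²≤X

  -- x √X + y √X = (x + y) √X, where the cross term p q ≤ x y X is obtained by comparing squares.
  +-≤√ : ∀ {p q x y X} → 0ℚ ≤ x → 0ℚ ≤ y → 0ℚ ≤ X →
         p ≤√ x * x * X → q ≤√ y * y * X → p + q ≤√ (x + y) * (x + y) * X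
  +-≤√ {p} {q} {x} {y} {X} 0≤x 0≤y 0≤X (0≤p , p²≤) (0≤q , q²≤) = +-mono-≤ 0≤p 0≤q , (begin
    (p + q) * (p + q)
      ≡⟨ solve 2 (λ p q → (p :+ q) :* (p :+ q) := p :* p :+ (p :* q :+ p :* q) :+ q :* q) refl p q ⟩
    p * p + (p * q + p * q) + q * q
      ≤⟨ +-mono-≤ (+-mono-≤ p²≤ (+-mono-≤ pq≤xyX pq≤xyX)) q²≤ ⟩
    x * x * X + (x * y * X + x * y * X) + y * y * X
      ≡⟨ solve 3 (λ x y X → x :* x :* X :+ (x :* y :* X :+ x :* y :* X) :+ y :* y :* X
                           := (x :+ y) :* (x :+ y) :* X) refl x y X ⟩
    (x + y) * (x + y) * X ∎)
    where
    open ≤-Reasoning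
    pq≤xyX : p * q ≤ x * y * X
    pq≤xyX = square-cancel-≤ (0≤* (0≤* 0≤x 0≤y) 0≤X) (begin
      p * q * (p * q)           ≡⟨ solve 2 (λ p q → p :* q :* (p :* q) := p :* p :* (q :* q)) refl p q ⟩
      p * p * (q * q)           ≤⟨ *-mono-≤-0≤ (0≤* 0≤p 0≤p) (0≤* 0≤q 0≤q) p²≤ q²≤ ⟩
      x * x * X * (y * y * X)   ≡⟨ solve 3 (λ x y X → x :* x :* X :* (y :* y :* X) := x :* y :* X :* (x :* y :* X))
                                           refl x y X ⟩
      x * y * X * (x * y * X)   ∎)

  0≤sumℚ : ∀ {A : Set} {g : A → ℚ} xs → (∀ {x} → x ∈ xs → 0ℚ ≤ g x) → 0ℚ ≤ sumℚ (map g xs)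
  0≤sumℚ []       0≤g = ≤-refl
  0≤sumℚ (x ∷ xs) 0≤g = +-mono-≤ (0≤g (here refl)) (0≤sumℚ xs (0≤g ∘ there))

  ∈⇒≤sumℚ : ∀ {A : Set} {g : A → ℚ} {x} xs → (∀ {x} → x ∈ xs → 0ℚ ≤ g x) → x ∈ xs →
            g x ≤ sumℚ (map g xs)
  ∈⇒≤sumℚ {g = g} (x ∷ xs) 0≤g (here refl) = subst (_≤ g x + sumℚ (map g xs)) (+-identityʳ (g x))
    (+-monoʳ-≤ (g x) (0≤sumℚ xs (0≤g ∘ there)))
  ∈⇒≤sumℚ {g = g} (x ∷ xs) 0≤g (there y∈xs) = subst (_≤ g x + sumℚ (map g xs)) (+-identityˡ _)
    (+-mono-≤ (0≤g (here refl)) (∈⇒≤sumℚ xs (0≤g ∘ there) y∈xs))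

  sumℚ-map-+ : ∀ {A : Set} (g h : A → ℚ) xs →
               sumℚ (map (λ x → g x + h x) xs) ≡ sumℚ (map g xs) + sumℚ (map h xs)
  sumℚ-map-+ g h []       = refl
  sumℚ-map-+ g h (x ∷ xs) = trans (cong (g x + h x +_) (sumℚ-map-+ g h xs))
    (solve 4 (λ a b c d → (a :+ b) :+ (c :+ d) := (a :+ c) :+ (b :+ d)) refl
             (g x) (h x) (sumℚ (map g xs)) (sumℚ (map h xs)))

  restrict : ∀ {A : Set} {ℓ} {P : Pred A ℓ} → Decidable P → (A → ℚ) → A → ℚ
  restrict P? g x with P? x
  ... | yes _ = g x
  ... | no  _ = 0ℚ

  restrict-elim : ∀ {A : Set} {ℓ} {P : Pred A ℓ} (P? : Decidable P) (Q : ℚ → Set) {g : A → ℚ} {x} →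
                  Q 0ℚ → (P x → Q (g x)) → Q (restrict P? g x)
  restrict-elim P? Q {x = x} Q0 Qg with P? x
  ... | yes px = Qg px
  ... | no  _  = Q0

  restrict-yes : ∀ {A : Set} {ℓ} {P : Pred A ℓ} (P? : Decidable P) (g : A → ℚ) {x} →
                 P x → restrict P? g x ≡ g x
  restrict-yes P? g {x} px with P? x
  ... | yes _   = refl
  ... | no  ¬px = contradiction px ¬px

  0≤restrict : ∀ {A : Set} {ℓ} {P : Pred A ℓ} (P? : Decidable P) {g : A → ℚ} {x} →
               0ℚ ≤ g x → 0ℚ ≤ restrict P? g x
  0≤restrict P? 0≤gx = restrict-elim P? (0ℚ ≤_) ≤-refl (λ _ → 0≤gx)

  sumℚ-filter : ∀ {A : Set} {ℓ} {P : Pred A ℓ} (P? : Decidable P) (g : A → ℚ) xs →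
                sumℚ (map g (filter P? xs)) ≡ sumℚ (map (restrict P? g) xs)
  sumℚ-filter P? g []       = refl
  sumℚ-filter P? g (x ∷ xs) with P? x
  ... | yes _ = cong (g x +_) (sumℚ-filter P? g xs)
  ... | no  _ = trans (sumℚ-filter P? g xs) (sym (+-identityˡ _))

  fibre : ∀ {A : Set} → (A → ℚ) → (A → ℕ) → ℕ → A → ℚ
  fibre g key k = restrict (λ x → key x ℕₚ.≟ k) g

  sumℚ-≤-sumℚ-fibres : ∀ {A : Set} (g : A → ℚ) key ks xs →
                       (∀ {x} → x ∈ xs → 0ℚ ≤ g x) → (∀ {x} → x ∈ xs → key x ∈ ks) →
                       sumℚ (map g xs) ≤ sumℚ (map (λ k → sumℚ (map (fibre g key k) xs)) ks)
  sumℚ-≤-sumℚ-fibres g key ks []       _   _    = 0≤sumℚ ks (λ _ → ≤-refl)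
  sumℚ-≤-sumℚ-fibres g key ks (x ∷ xs) 0≤g keys = begin
    g x + sumℚ (map g xs)
      ≤⟨ +-mono-≤ gx≤ (sumℚ-≤-sumℚ-fibres g key ks xs (0≤g ∘ there) (keys ∘ there)) ⟩
    sumℚ (map (λ k → fibre g key k x) ks) + sumℚ (map (λ k → sumℚ (map (fibre g key k) xs)) ks)
      ≡⟨ sumℚ-map-+ (λ k → fibre g key k x) (λ k → sumℚ (map (fibre g key k) xs)) ks ⟨
    sumℚ (map (λ k → fibre g key k x + sumℚ (map (fibre g key k) xs)) ks) ∎
    where
    open ≤-Reasoning
    gx≤ : g x ≤ sumℚ (map (λ k → fibre g key k x) ks)
    gx≤ = subst (_≤ sumℚ (map (λ k → fibre g key k x) ks)) (restrict-yes (λ y → key y ℕₚ.≟ key x) g refl)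
            (∈⇒≤sumℚ ks (λ {k} _ → 0≤restrict (λ x → key x ℕₚ.≟ k) (0≤g (here refl))) (keys (here refl)))

  sumℚ-≤√ : ∀ {A : Set} {g : A → ℚ} {X} xs → 0ℚ ≤ X → (∀ {x} → x ∈ xs → g x ≤√ X) →
            sumℚ (map g xs) ≤√ ℕ→ℚ (length xs) * ℕ→ℚ (length xs) * X
  sumℚ-≤√ {X = X} []       0≤X _  = ≤-refl , ≤-reflexive (sym (*-zeroˡ X))
  sumℚ-≤√ {g = g} {X} (x ∷ xs) 0≤X g≤√ =
    subst (λ N → g x + sumℚ (map g xs) ≤√ N * N * X) (sym (ℕ→ℚ-+ 1 (length xs)))
      (+-≤√ (0≤ℕ→ℚ 1) (0≤ℕ→ℚ (length xs)) 0≤X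
        (subst (_ ≤√_) (sym (*-identityˡ X)) (g≤√ (here refl))) (sumℚ-≤√ xs 0≤X (g≤√ ∘ there)))

  sumBelow : (ℕ → ℚ) → ℕ → ℚ
  sumBelow h N = sumℚ (applyUpTo h N)

  sumBelow-+ : ∀ h m n → sumBelow h (m ℕ.+ n) ≡ sumBelow h m + sumBelow (λ j → h (m ℕ.+ j)) n
  sumBelow-+ h zero    n = sym (+-identityˡ _)
  sumBelow-+ h (suc m) n = trans (cong (h 0 +_) (sumBelow-+ (h ∘ suc) m n))
    (sym (+-assoc (h 0) (sumBelow (h ∘ suc) m) _))

  sumBelow-suc : ∀ h N → sumBelow h (suc N) ≡ sumBelow h N + h N
  sumBelow-suc h zero    = +-comm (h 0) 0ℚ
  sumBelow-suc h (suc N) = trans (cong (h 0 +_) (sumBelow-suc (h ∘ suc) N))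
    (sym (+-assoc (h 0) (sumBelow (h ∘ suc) N) _))

  sumBelow-reverse : ∀ h N → sumBelow h N ≡ sumBelow (λ j → h (N ℕ.∸ suc j)) N
  sumBelow-reverse h zero    = refl
  sumBelow-reverse h (suc N) = begin
    sumBelow h (suc N)                              ≡⟨ sumBelow-suc h N ⟩
    sumBelow h N + h N                              ≡⟨ +-comm _ (h N) ⟩
    h N + sumBelow h N                              ≡⟨ cong (h N +_) (sumBelow-reverse h N) ⟩
    h N + sumBelow (λ j → h (N ℕ.∸ suc j)) N        ∎
    where open ≡-Reasoning

module InverseSqrtSums where

  open RationalArithmetic
  open RationalSums
  open import Data.Nat.Base using (zero)
  open import Data.Nat.Divisibility using (_∣_; divides)
  open import Data.Rational.Base
  open import Data.Rational.Properties
  open import Data.Rational.Solver using (module +-*-Solver)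
  open import Data.Product.Base using (∃-syntax; _,_)
  open import Data.Sum.Base using (_⊎_; inj₁; inj₂)
  open import Function.Base using (_∘_)
  open import Relation.Binary.PropositionalEquality
  open import Relation.Nullary using (contradiction)

  open +-*-Solver

  -- The scaled form 2 √(C V) + √(C / (V + 1)) ≤ 2 √(C (V + 1)) of
  -- √(V + 1) - √V ≥ 1 / (2 √(V + 1)); the cross term is compared through squares,
  -- 16 V (V + 1) ≤ (4 V + 3)².
  inverseSqrt-step : ∀ {s y C V} → 0ℚ ≤ C → 0ℚ ≤ V → 0ℚ ≤ y →
                     s ≤√ ℕ→ℚ 4 * C * V → y * y * (V + 1ℚ) ≤ C → s + y ≤√ ℕ→ℚ 4 * C * (V + 1ℚ)
  inverseSqrt-step {s} {y} {C} {V} 0≤C 0≤V 0≤y (0≤s , s²≤4CV) y²W≤C = +-mono-≤ 0≤s 0≤y , (begin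
    (s + y) * (s + y)
      ≡⟨ solve 2 (λ s y → (s :+ y) :* (s :+ y) := s :* s :+ (con 2ℚ :* s :* y :+ y :* y)) refl s y ⟩
    s * s + (2ℚ * s * y + y * y)
      ≤⟨ +-mono-≤ s²≤4CV (*-cancelʳ-≤-0< 0<W cross*W≤4CW) ⟩
    4ℚ * C * V + 4ℚ * C
      ≡⟨ solve 2 (λ C V → con 4ℚ :* C :* V :+ con 4ℚ :* C := con 4ℚ :* C :* (V :+ con 1ℚ)) refl C V ⟩
    4ℚ * C * (V + 1ℚ) ∎)
    where
    open ≤-Reasoning
    2ℚ 4ℚ : ℚ
    2ℚ = ℕ→ℚ 2
    4ℚ = ℕ→ℚ 4
    W = V + 1ℚ
    0<W : 0ℚ < W
    0<W = ≤-<-trans 0≤V (subst (_< W) (+-identityʳ V) (+-monoʳ-< V (positive⁻¹ 1ℚ)))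
    0≤W = <⇒≤ 0<W
    X = 2ℚ * s * y * W
    R = C * (4ℚ * V + ℕ→ℚ 3)
    X²≤R² : X * X ≤ R * R
    X²≤R² = begin
      X * X
        ≡⟨ solve 4 (λ s y W c → (c :* s :* y :* W) :* (c :* s :* y :* W)
                               := c :* c :* (s :* s) :* (y :* y :* W) :* W) refl s y W 2ℚ ⟩
      2ℚ * 2ℚ * (s * s) * (y * y * W) * W
        ≤⟨ *-monoʳ-≤-0≤ 0≤W (*-mono-≤-0≤ (0≤* (0≤ℕ→ℚ 4) (0≤* 0≤s 0≤s)) (0≤* (0≤* 0≤y 0≤y) 0≤W)
                                         (*-monoˡ-≤-0≤ (0≤ℕ→ℚ 4) s²≤4CV) y²W≤C) ⟩
      2ℚ * 2ℚ * (4ℚ * C * V) * C * W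
        ≤⟨ p≤p+q _ (0≤* (0≤* 0≤C 0≤C) (+-mono-≤ (0≤* (0≤ℕ→ℚ 8) 0≤V) (0≤ℕ→ℚ 9))) ⟩
      2ℚ * 2ℚ * (4ℚ * C * V) * C * W + C * C * (ℕ→ℚ 8 * V + ℕ→ℚ 9)
        ≡⟨ solve 2 (λ C V → con 2ℚ :* con 2ℚ :* (con 4ℚ :* C :* V) :* C :* (V :+ con 1ℚ)
                             :+ C :* C :* (con (ℕ→ℚ 8) :* V :+ con (ℕ→ℚ 9))
                           := (C :* (con 4ℚ :* V :+ con (ℕ→ℚ 3))) :* (C :* (con 4ℚ :* V :+ con (ℕ→ℚ 3))))
                   refl C V ⟩
      R * R ∎
    X≤R : X ≤ R
    X≤R = square-cancel-≤ (0≤* 0≤C (+-mono-≤ (0≤* (0≤ℕ→ℚ 4) 0≤V) (0≤ℕ→ℚ 3))) X²≤R²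
    cross*W≤4CW : (2ℚ * s * y + y * y) * W ≤ 4ℚ * C * W
    cross*W≤4CW = begin
      (2ℚ * s * y + y * y) * W
        ≡⟨ solve 3 (λ s y W → (con 2ℚ :* s :* y :+ y :* y) :* W := con 2ℚ :* s :* y :* W :+ y :* y :* W)
                   refl s y W ⟩
      X + y * y * W
        ≤⟨ +-mono-≤ X≤R y²W≤C ⟩
      R + C
        ≡⟨ solve 2 (λ C V → C :* (con 4ℚ :* V :+ con (ℕ→ℚ 3)) :+ C := con 4ℚ :* C :* (V :+ con 1ℚ)) refl C V ⟩
      4ℚ * C * W ∎

  -- y is 0, or y ≤ k / √m where m ≤ A is a multiple of k.
  MultipleTerm : ℕ → ℚ → ℕ → ℚ → Set
  MultipleTerm k A m y = 0ℚ ≤ y × (y ≡ 0ℚ ⊎ k ∣ m × y * y * ℕ→ℚ m ≤ ℕ→ℚ (k ℕ.* k) × ℕ→ℚ m ≤ A)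

  -- Σ_{j ≤ J} k / √(k j) ≤ 2 √(k J), where k J is the last multiple of k reached so far.
  sumBelow-≤√-lastMultiple : ∀ k {A} Y M → 0ℚ ≤ A → (∀ {j} → j ℕ.< M → MultipleTerm k A (suc j) (Y j)) →
    ∃[ J ] sumBelow Y M ≤√ ℕ→ℚ 4 * ℕ→ℚ (k ℕ.* J) × k ℕ.* J ℕ.≤ M × ℕ→ℚ (k ℕ.* J) ≤ A
  sumBelow-≤√-lastMultiple k {A} Y zero 0≤A _ =
    0 , (≤-refl , 0≤* (0≤ℕ→ℚ 4) (0≤ℕ→ℚ (k ℕ.* 0))) , ℕₚ.≤-reflexive (ℕₚ.*-zeroʳ k) ,
    subst (λ x → ℕ→ℚ x ≤ A) (sym (ℕₚ.*-zeroʳ k)) 0≤A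
  sumBelow-≤√-lastMultiple k {A} Y (suc M) 0≤A terms
    with sumBelow-≤√-lastMultiple k Y M 0≤A (terms ∘ ℕₚ.m<n⇒m<1+n) | terms (ℕₚ.n<1+n M)
  ... | J , sum≤√ , kJ≤M , kJ≤A | _ , inj₁ y≡0 =
    J , subst (_≤√ _) (sym sum≡) sum≤√ , ℕₚ.m≤n⇒m≤1+n kJ≤M , kJ≤A
    where
    sum≡ : sumBelow Y (suc M) ≡ sumBelow Y M
    sum≡ = trans (sumBelow-suc Y M) (trans (cong (sumBelow Y M +_) y≡0) (+-identityʳ _))
  ... | _ | _ , inj₂ (divides zero () , _)
  ... | J , sum≤√ , kJ≤M , kJ≤A | 0≤y , inj₂ (divides (suc v) 1+M≡[1+v]k , y²m≤k² , m≤A) =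
    suc v , subst (_≤√ _) (sym (sumBelow-suc Y M)) (subst (λ x → _ ≤√ ℕ→ℚ 4 * x) (sym kv′≡) step) ,
    ℕₚ.≤-reflexive (sym 1+M≡k[1+v]) , subst (λ x → ℕ→ℚ x ≤ A) 1+M≡k[1+v] m≤A
    where
    C = ℕ→ℚ k
    V = ℕ→ℚ v
    y = Y M
    1+M≡k[1+v] : suc M ≡ k ℕ.* suc v
    1+M≡k[1+v] = trans 1+M≡[1+v]k (ℕₚ.*-comm (suc v) k)
    0<C : 0ℚ < C
    0<C = ℕ→ℚ-mono-< {0} {k} (ℕₚ.n≢0⇒n>0 λ { refl → contradiction 1+M≡k[1+v] λ () })
    kv′≡ : ℕ→ℚ (k ℕ.* suc v) ≡ C * (V + 1ℚ)
    kv′≡ = trans (ℕ→ℚ-* k (suc v)) (cong (C *_) (ℕ→ℚ-suc v))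
    J≤v : J ℕ.≤ v
    J≤v = ℕₚ.≤-pred (ℕₚ.*-cancelˡ-< k J (suc v) (ℕₚ.≤-trans (ℕ.s≤s kJ≤M) (ℕₚ.≤-reflexive 1+M≡k[1+v])))
    y²W≤C : y * y * (V + 1ℚ) ≤ C
    y²W≤C = *-cancelʳ-≤-0< 0<C (begin
      y * y * (V + 1ℚ) * C   ≡⟨ solve 3 (λ y W C → y :* y :* W :* C := y :* y :* (C :* W)) refl y (V + 1ℚ) C ⟩
      y * y * (C * (V + 1ℚ)) ≡⟨ cong (y * y *_) (trans (sym kv′≡) (cong ℕ→ℚ (sym 1+M≡k[1+v]))) ⟩
      y * y * ℕ→ℚ (suc M)    ≤⟨ y²m≤k² ⟩
      ℕ→ℚ (k ℕ.* k)          ≡⟨ ℕ→ℚ-* k k ⟩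
      C * C                  ∎)
      where open ≤-Reasoning
    kJ≤CV : ℕ→ℚ (k ℕ.* J) ≤ C * V
    kJ≤CV = ≤-trans (ℕ→ℚ-mono-≤ (ℕₚ.*-monoʳ-≤ k J≤v)) (≤-reflexive (ℕ→ℚ-* k v))
    sum≤√4CV : sumBelow Y M ≤√ ℕ→ℚ 4 * C * V
    sum≤√4CV = ≤√-monoʳ (≤-trans (*-monoˡ-≤-0≤ (0≤ℕ→ℚ 4) kJ≤CV) (≤-reflexive (sym (*-assoc (ℕ→ℚ 4) C V)))) sum≤√
    step : sumBelow Y M + y ≤√ ℕ→ℚ 4 * (C * (V + 1ℚ))
    step = subst (_ ≤√_) (*-assoc (ℕ→ℚ 4) C (V + 1ℚ)) (inverseSqrt-step (<⇒≤ 0<C) (0≤ℕ→ℚ v) 0≤y sum≤√4CV y²W≤C)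

  sumBelow-≤√ : ∀ k {A} Y M → 0ℚ ≤ A → (∀ {j} → j ℕ.< M → MultipleTerm k A (suc j) (Y j)) →
                sumBelow Y M ≤√ ℕ→ℚ 4 * A
  sumBelow-≤√ k Y M 0≤A terms =
    let _ , sum≤√ , _ , kJ≤A = sumBelow-≤√-lastMultiple k Y M 0≤A terms
    in ≤√-monoʳ (*-monoˡ-≤-0≤ (0≤ℕ→ℚ 4) kJ≤A) sum≤√

module RangeSum where

  open RationalArithmetic
  open RationalSums
  open InverseSqrtSums
  open SquareDivisor using (S∣n; S∣n∸∣f∣)
  open DivisorCount using (AllDivisorsIn)
  open import Data.Nat.Divisibility using (_∣_)
  open import Data.Integer.Base using (+_)
  import Data.Integer.Properties as ℤₚ
  open import Data.Rational.Base
  open import Data.Rational.Properties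
  open import Data.Rational.Solver using (module +-*-Solver)
  open import Data.List.Base using (upTo; length)
  import Data.List.Properties as List
  open import Data.List.Membership.Propositional using (_∈_)
  open import Data.List.Membership.Propositional.Properties using (∈-filter⁺; ∈-map⁺; ∈-upTo⁺)
  import Data.List.Relation.Unary.All as All
  open import Data.Product.Base using (_,_; proj₁)
  open import Data.Sum.Base using (inj₁; inj₂)
  open import Function.Base using (_∘_; id)
  open import Relation.Binary.PropositionalEquality

  open +-*-Solver

  -- Both halves are listed so that n - |f| increases, as sumBelow-≤√ requires.
  sumℚ-smallInts : ∀ (g : ℤ → ℚ) n′ → sumℚ (map g (smallInts (suc n′))) ≡
    sumBelow (λ j → g (+ j ℤ.- + n′)) n′ + sumBelow (λ j → g (+ (n′ ℕ.+ (n′ ℕ.∸ j)) ℤ.- + n′)) (suc n′)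
  sumℚ-smallInts g n′ = begin
    sumℚ (map g (map φ (upTo N)))                   ≡⟨ cong sumℚ (List.map-∘ {g = g} {f = φ} (upTo N)) ⟨
    sumℚ (map (g ∘ φ) (upTo N))                     ≡⟨ cong sumℚ (List.map-applyUpTo id (g ∘ φ) N) ⟩
    sumBelow (g ∘ φ) N                              ≡⟨ cong (sumBelow (g ∘ φ)) (ℕₚ.+-suc n′ n′) ⟨
    sumBelow (g ∘ φ) (n′ ℕ.+ suc n′)                ≡⟨ sumBelow-+ (g ∘ φ) n′ (suc n′) ⟩
    sumBelow (g ∘ φ) n′ + sumBelow (λ j → g (φ (n′ ℕ.+ j))) (suc n′)
      ≡⟨ cong (λ x → sumBelow (g ∘ φ) n′ + x) (sumBelow-reverse (λ j → g (φ (n′ ℕ.+ j))) (suc n′)) ⟩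
    sumBelow (g ∘ φ) n′ + sumBelow (λ j → g (φ (n′ ℕ.+ (n′ ℕ.∸ j)))) (suc n′) ∎
    where
    open ≡-Reasoning
    N = suc (n′ ℕ.+ n′)
    φ : ℕ → ℤ
    φ i = + i ℤ.- + n′

  ∣+i-+n∣≡n∸i : ∀ {i n} → i ℕ.≤ n → ℤ.∣ + i ℤ.- + n ∣ ≡ n ℕ.∸ i
  ∣+i-+n∣≡n∸i {i} {n} i≤n = begin
    ℤ.∣ + i ℤ.- + n ∣      ≡⟨ cong ℤ.∣_∣ (ℤₚ.[+m]-[+n]≡m⊖n i n) ⟩
    ℤ.∣ i ℤ.⊖ n ∣          ≡⟨ cong ℤ.∣_∣ (ℤₚ.⊖-≤ i≤n) ⟩
    ℤ.∣ ℤ.- + (n ℕ.∸ i) ∣  ≡⟨ ℤₚ.∣-i∣≡∣i∣ (+ (n ℕ.∸ i)) ⟩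
    n ℕ.∸ i                ∎
    where open ≡-Reasoning

  ∣+[n+i]-+n∣≡i : ∀ n i → ℤ.∣ + (n ℕ.+ i) ℤ.- + n ∣ ≡ i
  ∣+[n+i]-+n∣≡i n i = begin
    ℤ.∣ + (n ℕ.+ i) ℤ.- + n ∣  ≡⟨ cong ℤ.∣_∣ (ℤₚ.[+m]-[+n]≡m⊖n (n ℕ.+ i) n) ⟩
    ℤ.∣ (n ℕ.+ i) ℤ.⊖ n ∣      ≡⟨ cong ℤ.∣_∣ (ℤₚ.⊖-≥ (ℕₚ.m≤m+n n i)) ⟩
    n ℕ.+ i ℕ.∸ n              ≡⟨ ℕₚ.m+n∸m≡n n i ⟩
    i                          ∎
    where open ≡-Reasoning

  module _ (n′ : ℕ) {A : ℚ} (0≤A : 0ℚ ≤ A) (r : ℤ → ℚ)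
           (lower : All (LowerApprox (suc n′) r) (range (suc n′) A)) where

    private
      n = suc n′
      InRange? = λ (f : ℤ) → (ℕ→ℚ n - A) ≤? ℕ→ℚ ℤ.∣ f ∣

    restricted-multipleTerm : ∀ k {f} → f ∈ smallInts n → ∀ {j} → j ℕ.≤ n′ → ℤ.∣ f ∣ ≡ n′ ℕ.∸ j →
                              MultipleTerm k A (suc j) (restrict InRange? (fibre r (S n) k) f)
    restricted-multipleTerm k {f} f∈ {j} j≤n′ ∣f∣≡ =
      restrict-elim InRange? (MultipleTerm k A (suc j)) {fibre r (S n) k} {f} (≤-refl , inj₁ refl) λ inRange →
      restrict-elim (λ x → S n x ℕₚ.≟ k) (MultipleTerm k A (suc j)) {r} {f} (≤-refl , inj₁ refl) λ { refl →
      let 0≤r , r²m≤S² = All.lookup lower (∈-filter⁺ InRange? f∈ inRange) in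
      0≤r , inj₂ (subst (S n f ∣_) m≡ (S∣n∸∣f∣ n f) ,
                  subst (λ m → r f * r f * ℕ→ℚ m ≤ ℕ→ℚ (S n f ℕ.* S n f)) m≡ r²m≤S² ,
                  subst (λ m → ℕ→ℚ m ≤ A) m≡ (m≤A inRange)) }
      where
      ∣f∣≤n : ℤ.∣ f ∣ ℕ.≤ n
      ∣f∣≤n = ℕₚ.≤-trans (ℕₚ.≤-reflexive ∣f∣≡) (ℕₚ.≤-trans (ℕₚ.m∸n≤m n′ j) (ℕₚ.n≤1+n n′))
      m≤A : ℕ→ℚ n - A ≤ ℕ→ℚ ℤ.∣ f ∣ → ℕ→ℚ (n ℕ.∸ ℤ.∣ f ∣) ≤ A
      m≤A inRange = subst (_≤ A) (sym (ℕ→ℚ-∸ ∣f∣≤n)) (p-r≤q⇒p-q≤r {ℕ→ℚ n} {ℕ→ℚ ℤ.∣ f ∣} {A} inRange)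
      m≡ : n ℕ.∸ ℤ.∣ f ∣ ≡ suc j
      m≡ = begin
        n ℕ.∸ ℤ.∣ f ∣              ≡⟨ cong (n ℕ.∸_) ∣f∣≡ ⟩
        suc n′ ℕ.∸ (n′ ℕ.∸ j)      ≡⟨ ℕₚ.+-∸-assoc 1 (ℕₚ.m∸n≤m n′ j) ⟩
        suc (n′ ℕ.∸ (n′ ℕ.∸ j))    ≡⟨ cong suc (ℕₚ.m∸[m∸n]≡n j≤n′) ⟩
        suc j                      ∎
        where open ≡-Reasoning

    fibreSum-≤√ : ∀ k → sumℚ (map (fibre r (S n) k) (range n A)) ≤√ (1ℚ + 1ℚ) * (1ℚ + 1ℚ) * (ℕ→ℚ 4 * A)
    fibreSum-≤√ k = subst (_≤√ _) (sym split)
      (+-≤√ (0≤ℕ→ℚ 1) (0≤ℕ→ℚ 1) 0≤4A (1*1*-≤√ (sumBelow-≤√ k _ n′ 0≤A negativeHalf))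
                                      (1*1*-≤√ (sumBelow-≤√ k _ (suc n′) 0≤A nonNegativeHalf)))
      where
      g = restrict InRange? (fibre r (S n) k)
      φ : ℕ → ℤ
      φ i = + i ℤ.- + n′
      split : sumℚ (map (fibre r (S n) k) (range n A)) ≡
              sumBelow (g ∘ φ) n′ + sumBelow (λ j → g (φ (n′ ℕ.+ (n′ ℕ.∸ j)))) (suc n′)
      split = trans (sumℚ-filter InRange? (fibre r (S n) k) (smallInts n)) (sumℚ-smallInts g n′)
      φ∈ : ∀ {i} → i ℕ.≤ n′ ℕ.+ n′ → φ i ∈ smallInts n
      φ∈ i≤ = ∈-map⁺ φ (∈-upTo⁺ (ℕ.s≤s i≤))
      0≤4A = 0≤* (0≤ℕ→ℚ 4) 0≤A
      1*1*-≤√ : ∀ {p} → p ≤√ ℕ→ℚ 4 * A → p ≤√ 1ℚ * 1ℚ * (ℕ→ℚ 4 * A)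
      1*1*-≤√ = subst (_ ≤√_) (sym (*-identityˡ _))
      negativeHalf : ∀ {j} → j ℕ.< n′ → MultipleTerm k A (suc j) (g (φ j))
      negativeHalf {j} j<n′ = restricted-multipleTerm k (φ∈ (ℕₚ.≤-trans (ℕₚ.<⇒≤ j<n′) (ℕₚ.m≤m+n n′ n′)))
                            (ℕₚ.<⇒≤ j<n′) (∣+i-+n∣≡n∸i (ℕₚ.<⇒≤ j<n′))
      nonNegativeHalf : ∀ {j} → j ℕ.< suc n′ → MultipleTerm k A (suc j) (g (φ (n′ ℕ.+ (n′ ℕ.∸ j))))
      nonNegativeHalf {j} (ℕ.s≤s j≤n′) = restricted-multipleTerm k (φ∈ (ℕₚ.+-monoʳ-≤ n′ (ℕₚ.m∸n≤m n′ j)))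
                            j≤n′ (∣+[n+i]-+n∣≡i n′ (n′ ℕ.∸ j))

    sumℚ-range-≤√ : ∀ ks → AllDivisorsIn n ks →
                    sumℚ (map r (range n A)) ≤√ ℕ→ℚ (16 ℕ.* (length ks ℕ.* length ks)) * A
    sumℚ-range-≤√ ks n⊆ks = subst (_ ≤√_) constant (≤-≤√-trans (0≤sumℚ (range n A) 0≤r)
      (sumℚ-≤-sumℚ-fibres r (S n) ks (range n A) 0≤r (λ {f} _ → n⊆ks (S∣n n f)))
      (sumℚ-≤√ ks (0≤* (0≤* (0≤ℕ→ℚ 2) (0≤ℕ→ℚ 2)) (0≤* (0≤ℕ→ℚ 4) 0≤A)) (λ {k} _ → fibreSum-≤√ k)))
      where
      0≤r : ∀ {f} → f ∈ range n A → 0ℚ ≤ r f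
      0≤r f∈ = proj₁ (All.lookup lower f∈)
      D = ℕ→ℚ (length ks)
      constant : D * D * ((1ℚ + 1ℚ) * (1ℚ + 1ℚ) * (ℕ→ℚ 4 * A)) ≡ ℕ→ℚ (16 ℕ.* (length ks ℕ.* length ks)) * A
      constant = begin
        D * D * ((1ℚ + 1ℚ) * (1ℚ + 1ℚ) * (ℕ→ℚ 4 * A))
          ≡⟨ solve 2 (λ D A → D :* D :* ((con 1ℚ :+ con 1ℚ) :* (con 1ℚ :+ con 1ℚ) :* (con (ℕ→ℚ 4) :* A))
                           := con (ℕ→ℚ 16) :* (D :* D) :* A) refl D A ⟩
        ℕ→ℚ 16 * (D * D) * A                          ≡⟨ cong (λ x → ℕ→ℚ 16 * x * A) (ℕ→ℚ-* (length ks) (length ks)) ⟨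
        ℕ→ℚ 16 * ℕ→ℚ (length ks ℕ.* length ks) * A    ≡⟨ cong (_* A) (ℕ→ℚ-* 16 (length ks ℕ.* length ks)) ⟨
        ℕ→ℚ (16 ℕ.* (length ks ℕ.* length ks)) * A    ∎
        where open ≡-Reasoning

open RationalArithmetic
open RationalSums using (_≤√_)
open DivisorCount using (DivisorCountBound; weight; weight>0; divisorCountBound; ^-distribʳ-*)
open RangeSum using (sumℚ-range-≤√)
open import Data.Nat.Base using (NonZero)
open import Data.Nat.Tactic.RingSolver using (solve-∀)
open import Data.Rational.Properties using (≤-trans; module ≤-Reasoning)
open import Data.Product.Base using (_,_; proj₁; proj₂)
open import Data.List.Base using (length)
open import Relation.Binary.PropositionalEquality

m≤m^n : ∀ m .{{_ : NonZero m}} {n} → 1 ℕ.≤ n → m ℕ.≤ m ℕ.^ n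
m≤m^n m 1≤n = ℕₚ.≤-trans (ℕₚ.≤-reflexive (sym (ℕₚ.*-identityʳ m))) (ℕₚ.^-monoʳ-≤ m 1≤n)

[16D²]^Q≤[4E]^[2Q]*t^[2p] : ∀ {D E n t} p Q .{{_ : NonZero E}} .{{_ : NonZero t}} → 1 ℕ.≤ p → 1 ℕ.≤ Q →
  D ℕ.^ (2 ℕ.* Q) ℕ.≤ E ℕ.* n → n ℕ.≤ t ℕ.* t →
  (16 ℕ.* (D ℕ.* D)) ℕ.^ Q ℕ.≤ (4 ℕ.* E) ℕ.^ (2 ℕ.* Q) ℕ.* t ℕ.^ (2 ℕ.* p)
[16D²]^Q≤[4E]^[2Q]*t^[2p] {D} {E} {n} {t} p Q 1≤p 1≤Q D^2Q≤En n≤t² = begin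
  (16 ℕ.* (D ℕ.* D)) ℕ.^ Q                                  ≡⟨ cong (ℕ._^ Q) (square D) ⟩
  ((4 ℕ.* D) ℕ.^ 2) ℕ.^ Q                                   ≡⟨ ℕₚ.^-*-assoc (4 ℕ.* D) 2 Q ⟩
  (4 ℕ.* D) ℕ.^ (2 ℕ.* Q)                                   ≡⟨ ^-distribʳ-* 4 D (2 ℕ.* Q) ⟩
  4^2Q ℕ.* D ℕ.^ (2 ℕ.* Q)                                  ≤⟨ ℕₚ.*-monoʳ-≤ 4^2Q D^2Q≤En ⟩
  4^2Q ℕ.* (E ℕ.* n)                                        ≤⟨ ℕₚ.*-monoʳ-≤ 4^2Q (ℕₚ.*-mono-≤ E≤E^2Q n≤t^2p) ⟩
  4^2Q ℕ.* (E ℕ.^ (2 ℕ.* Q) ℕ.* t ℕ.^ (2 ℕ.* p))            ≡⟨ ℕₚ.*-assoc 4^2Q _ _ ⟨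
  4^2Q ℕ.* E ℕ.^ (2 ℕ.* Q) ℕ.* t ℕ.^ (2 ℕ.* p)              ≡⟨ cong (ℕ._* t ℕ.^ (2 ℕ.* p)) (^-distribʳ-* 4 E (2 ℕ.* Q)) ⟨
  (4 ℕ.* E) ℕ.^ (2 ℕ.* Q) ℕ.* t ℕ.^ (2 ℕ.* p)               ∎
  where
  open ℕₚ.≤-Reasoning
  4^2Q = 4 ℕ.^ (2 ℕ.* Q)
  square : ∀ x → 16 ℕ.* (x ℕ.* x) ≡ 4 ℕ.* x ℕ.* (4 ℕ.* x ℕ.* 1)
  square = solve-∀
  E≤E^2Q : E ℕ.≤ E ℕ.^ (2 ℕ.* Q)
  E≤E^2Q = m≤m^n E (ℕₚ.≤-trans 1≤Q (ℕₚ.m≤m+n Q _))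
  n≤t^2p : n ℕ.≤ t ℕ.^ (2 ℕ.* p)
  n≤t^2p = ℕₚ.≤-trans n≤t² (ℕₚ.≤-trans (ℕₚ.≤-reflexive (cong (t ℕ.*_) (sym (ℕₚ.*-identityʳ t))))
                                         (ℕₚ.^-monoʳ-≤ t (ℕₚ.*-monoʳ-≤ 2 1≤p)))

sumℚ-range-^-≤ : ∀ p q {E} .{{_ : NonZero E}} → 1 ℕ.≤ p →
  ∀ t .{{_ : NonZero t}} n .{{_ : NonZero n}} → n ℕ.≤ t ℕ.* t → DivisorCountBound (2 ℕ.* suc q) E n →
  ∀ {A} → 0ℚ ℚ.≤ A → ∀ r → All (LowerApprox n r) (range n A) →
  sumℚ (map r (range n A)) ^ℚ (2 ℕ.* suc q)
    ℚ.≤ (ℕ→ℚ (4 ℕ.* E) ^ℚ (2 ℕ.* suc q) ℚ.* ℕ→ℚ t ^ℚ (2 ℕ.* p)) ℚ.* A ^ℚ suc q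
sumℚ-range-^-≤ p q {E} 1≤p t n@(suc n′) n≤t² (ks , n⊆ks , D^2Q≤En) {A} 0≤A r lower = begin
  Σr ^ℚ (2 ℕ.* Q)                                                ≡⟨ ^ℚ-2* Σr Q ⟩
  (Σr ℚ.* Σr) ^ℚ Q                                               ≤⟨ ^ℚ-mono-≤ Q (0≤* 0≤Σr 0≤Σr) Σr²≤ ⟩
  (ℕ→ℚ (16 ℕ.* (D ℕ.* D)) ℚ.* A) ^ℚ Q                           ≡⟨ ^ℚ-distrib-* (ℕ→ℚ (16 ℕ.* (D ℕ.* D))) A Q ⟩
  ℕ→ℚ (16 ℕ.* (D ℕ.* D)) ^ℚ Q ℚ.* A ^ℚ Q                        ≡⟨ cong (ℚ._* A ^ℚ Q) (ℕ→ℚ-^ (16 ℕ.* (D ℕ.* D)) Q) ⟨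
  ℕ→ℚ ((16 ℕ.* (D ℕ.* D)) ℕ.^ Q) ℚ.* A ^ℚ Q                     ≤⟨ *-monoʳ-≤-0≤ (0≤^ℚ Q 0≤A) (ℕ→ℚ-mono-≤ constant≤) ⟩
  ℕ→ℚ ((4 ℕ.* E) ℕ.^ (2 ℕ.* Q) ℕ.* t ℕ.^ (2 ℕ.* p)) ℚ.* A ^ℚ Q   ≡⟨ cong (ℚ._* A ^ℚ Q) cast ⟩
  (ℕ→ℚ (4 ℕ.* E) ^ℚ (2 ℕ.* Q) ℚ.* ℕ→ℚ t ^ℚ (2 ℕ.* p)) ℚ.* A ^ℚ Q ∎
  where
  open ≤-Reasoning
  Q = suc q
  D = length ks
  Σr = sumℚ (map r (range n A))
  Σr≤√ : Σr ≤√ ℕ→ℚ (16 ℕ.* (D ℕ.* D)) ℚ.* A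
  Σr≤√ = sumℚ-range-≤√ n′ 0≤A r lower ks n⊆ks
  0≤Σr = proj₁ Σr≤√
  Σr²≤ = proj₂ Σr≤√
  constant≤ : (16 ℕ.* (D ℕ.* D)) ℕ.^ Q ℕ.≤ (4 ℕ.* E) ℕ.^ (2 ℕ.* Q) ℕ.* t ℕ.^ (2 ℕ.* p)
  constant≤ = [16D²]^Q≤[4E]^[2Q]*t^[2p] {D} {E} {n} {t} p Q 1≤p (ℕ.s≤s ℕ.z≤n) D^2Q≤En n≤t²
  cast : ℕ→ℚ ((4 ℕ.* E) ℕ.^ (2 ℕ.* Q) ℕ.* t ℕ.^ (2 ℕ.* p)) ≡ ℕ→ℚ (4 ℕ.* E) ^ℚ (2 ℕ.* Q) ℚ.* ℕ→ℚ t ^ℚ (2 ℕ.* p)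
  cast = trans (ℕ→ℚ-* ((4 ℕ.* E) ℕ.^ (2 ℕ.* Q)) (t ℕ.^ (2 ℕ.* p)))
               (cong₂ ℚ._*_ (ℕ→ℚ-^ (4 ℕ.* E) (2 ℕ.* Q)) (ℕ→ℚ-^ t (2 ℕ.* p)))

2<t⇒t*t∸4≢0 : ∀ {t} → 2 ℕ.< t → NonZero (t ℕ.* t ℕ.∸ 4)
2<t⇒t*t∸4≢0 {t} 2<t = ℕ.>-nonZero (ℕₚ.∸-monoˡ-< {4} {4} {t ℕ.* t} (ℕₚ.*-mono-< 2<t 2<t) ℕₚ.≤-refl)

lemma3p7 : (p q : ℕ) → 1 ℕ.≤ p → (K : ℚ) →
    Σ ℚ (λ C → (0ℚ ℚ.≤ C) ×
      ((t : ℕ) → 2 ℕ.< t → (A : ℚ) → 1ℚ ℚ.≤ A → A ℚ.≤ K ℚ.* ℕ→ℚ (t ℕ.* t) →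
        (r : ℤ → ℚ) → All (LowerApprox (t ℕ.* t ℕ.∸ 4) r) (range (t ℕ.* t ℕ.∸ 4) A) →
        sumℚ (map r (range (t ℕ.* t ℕ.∸ 4) A)) ^ℚ (2 ℕ.* suc q)
          ℚ.≤ ((C ^ℚ (2 ℕ.* suc q)) ℚ.* (ℕ→ℚ t ^ℚ (2 ℕ.* p))) ℚ.* (A ^ℚ suc q)))
lemma3p7 p q 1≤p _ =
  ℕ→ℚ (4 ℕ.* E) , 0≤ℕ→ℚ (4 ℕ.* E) , λ t 2<t A 1≤A _ r lower →
    sumℚ-range-^-≤ p q 1≤p t {{ℕ.>-nonZero (ℕₚ.<-trans ℕ.z<s 2<t)}} (t ℕ.* t ℕ.∸ 4) {{2<t⇒t*t∸4≢0 2<t}}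
      (ℕₚ.m∸n≤m (t ℕ.* t) 4) (divisorCountBound a (t ℕ.* t ℕ.∸ 4) {{2<t⇒t*t∸4≢0 2<t}})
      (≤-trans (0≤ℕ→ℚ 1) 1≤A) r lower
  where
  a = 2 ℕ.* suc q
  E = weight a 2
  instance
    E≢0 : NonZero E
    E≢0 = ℕ.>-nonZero (weight>0 a 2)
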